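{- Let $c,k,q,t,t_0,y$ be integers where $q$ is a prime power, $y \ne 0$, and $c \le k-t$ as well as $t_0 \le t$. Then \[q^{t_0 c}\binom{k-t_0}{c}_q \binom{t_0}{y}_q \le q^{tc}\binom{k-t}{c}_q \binom{t}{y}_q\text{.}\]
   Context: $\binom{n}{m}_q=\prod_{i=0}^{m-1}\frac{q^n-q^i}{q^m-q^i}$ denotes the Gaussian ($q$-)binomial coefficient for $0\le m\le n$, and $0$ otherwise. The quantity $q^{uc}\binom{w-u}{c}_q$ (for $0\le c\le w-u$, and $0$ otherwise) is the number of $c$-dimensional subspaces of a $w$-dimensional space $W$ that intersect a given $u$-dimensional subspace of $W$ trivially. -}

module Defs where

open import Data.Nat as ℕ using (ℕ; zero; suc)
open import Data.Nat.Primality using (Prime)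
open import Data.Integer as ℤ using (ℤ; +_; -[1+_]; ∣_∣)
open import Data.Rational as ℚ using (ℚ; 0ℚ; 1ℚ; _÷_; _*_; _-_; _≟_; ≢-nonZero)
open import Data.Product using (Σ; _×_)
open import Relation.Nullary using (yes; no)
open import Relation.Nullary.Decidable using (_×-dec_)
open import Relation.Binary.PropositionalEquality using (_≡_)

IsPrimePower : ℤ → Set
IsPrimePower q = Σ ℕ λ p → Σ ℕ λ e → Prime p × (1 ℕ.≤ e) × (q ≡ + (p ℕ.^ e))

toℚ : ℤ → ℚ
toℚ z = z ℚ./ 1

-- division in ℚ; the denominators used below are never zero for q ≥ 2,
-- the zero-branch is only there to make the function total.
_÷′_ : ℚ → ℚ → ℚ
a ÷′ b with b ≟ 0ℚ
... | yes _ = 0ℚ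
... | no b≢0 = _÷_ a b {{≢-nonZero b≢0}}

_^ℕ_ : ℚ → ℕ → ℚ
x ^ℕ zero = 1ℚ
x ^ℕ suc n = x * (x ^ℕ n)

_^ℤ_ : ℚ → ℤ → ℚ
x ^ℤ (+ n) = x ^ℕ n
x ^ℤ -[1+ n ] = 1ℚ ÷′ (x ^ℕ suc n)

prodℚ : ℕ → (ℕ → ℚ) → ℚ
prodℚ zero f = 1ℚ
prodℚ (suc m) f = prodℚ m f * f m

gauss : ℤ → ℤ → ℤ → ℚ
gauss q n m with (ℤ.+ 0 ℤ.≤? m) ×-dec (m ℤ.≤? n)
... | yes _ = prodℚ ∣ m ∣ λ i →
        ((toℚ q ^ℕ ∣ n ∣) - (toℚ q ^ℕ i)) ÷′ ((toℚ q ^ℕ ∣ m ∣) - (toℚ q ^ℕ i))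
... | no _ = 0ℚ

module Submission where

-- Put F(t) = q^{tc} [k−t, c]_q [t, y]_q. If c ∉ [0, k−t₀] or y ∉ [0, t₀], then F(t₀) = 0 ≤ F(t).
-- Otherwise every step from t to t+1 between t₀ and t multiplies F by
--   q^c · ([t+1, y]_q / [t, y]_q) / ([m+1, c]_q / [m, c]_q),   m = k−t−1 ≥ c,
-- and [m+1, c]_q / [m, c]_q = q^c (q^{m+1} − 1)/(q^{m+1} − q^c) ≤ q^c · q/(q − 1), while
-- [t+1, y]_q / [t, y]_q = q^{y−1} (q^{t+1} − 1)/(q^t − q^{y−1}) ≥ q because y ≥ 1; so the factor
-- is at least q − 1 ≥ 1. Clearing the denominators ∏_{i<m} (q^m − q^i) of the Gaussian binomials
-- turns each step into an inequality between natural numbers.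

module QFalling where
  open import Data.Nat
  open import Data.Nat.Properties
  open import Data.Nat.Solver using (module +-*-Solver)
  open import Relation.Binary.PropositionalEquality
  open +-*-Solver

  prodℕ : ℕ → (ℕ → ℕ) → ℕ
  prodℕ zero    f = 1
  prodℕ (suc m) f = prodℕ m f * f m

  -- ∏_{i<m} (q^n − q^i): the number of injective linear maps 𝔽_q^m → 𝔽_q^n.
  qFalling : ℕ → ℕ → ℕ → ℕ
  qFalling q n m = prodℕ m (λ i → q ^ n ∸ q ^ i)

  qFalling-suc : ∀ q n m → qFalling q (suc n) (suc m) ≡ (q ^ suc n ∸ 1) * (q ^ m * qFalling q n m)
  qFalling-suc q n zero =
    solve 1 (λ x → con 1 :* x := x :* (con 1 :* con 1)) refl (q ^ suc n ∸ 1)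
  qFalling-suc q n (suc m) = begin
    qFalling q (suc n) (suc m) * (q ^ suc n ∸ q ^ suc m)
      ≡⟨ cong₂ _*_ (qFalling-suc q n m) (sym (*-distribˡ-∸ q (q ^ n) (q ^ m))) ⟩
    (q ^ suc n ∸ 1) * (q ^ m * qFalling q n m) * (q * (q ^ n ∸ q ^ m))
      ≡⟨ solve 5 (λ a p f x d → a :* (p :* f) :* (x :* d) := a :* (x :* p :* (f :* d))) refl
           (q ^ suc n ∸ 1) (q ^ m) (qFalling q n m) q (q ^ n ∸ q ^ m) ⟩
    (q ^ suc n ∸ 1) * (q ^ suc m * qFalling q n (suc m)) ∎
    where open ≡-Reasoning

  *-∸1-≤ : ∀ s x → 2+ s * (x ∸ 1) ≤ suc s * (2+ s * x ∸ 1)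
  *-∸1-≤ s zero    rewrite *-zeroʳ (2+ s) = z≤n
  *-∸1-≤ s (suc x) = subst (2+ s * x ≤_) expand (m≤m+n _ _)
    where
    expand : 2+ s * x + (suc s * suc s + (2 * s + s * s) * x) ≡ suc s * (x + suc s * suc x)
    expand = solve 2 (λ s x → (con 2 :+ s) :* x :+ ((con 1 :+ s) :* (con 1 :+ s) :+ (con 2 :* s :+ s :* s) :* x)
                            := (con 1 :+ s) :* (x :+ (con 1 :+ s) :* (con 1 :+ x))) refl s x

  module _ (s : ℕ) where
    private
      q = 2+ s

    ^-∸-pos : ∀ {i n} → i < n → 0 < q ^ n ∸ q ^ i
    ^-∸-pos i<n = m<n⇒0<n∸m (^-monoʳ-< q (s≤s (s≤s z≤n)) i<n)

    qFalling-pos : ∀ {n} m → m ≤ n → 0 < qFalling q n m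
    qFalling-pos zero    _     = z<s
    qFalling-pos (suc m) m<n = *-mono-≤ (qFalling-pos m (<⇒≤ m<n)) (^-∸-pos m<n)

    ^-∸-≤ : ∀ a z → q ^ a ∸ q ^ z ≤ q ^ z * (q ^ a ∸ 1)
    ^-∸-≤ a z = begin
      q ^ a ∸ q ^ z           ≤⟨ ∸-monoˡ-≤ (q ^ z) (m≤n*m (q ^ a) (q ^ z) {{m^n≢0 q z}}) ⟩
      q ^ z * q ^ a ∸ q ^ z   ≡⟨ cong (q ^ z * q ^ a ∸_) (sym (*-identityʳ (q ^ z))) ⟩
      q ^ z * q ^ a ∸ q ^ z * 1 ≡⟨ sym (*-distribˡ-∸ (q ^ z) (q ^ a) 1) ⟩
      q ^ z * (q ^ a ∸ 1)     ∎
      where open ≤-Reasoning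

    pred*^-≤ : ∀ {c n} → c ≤ n → (q ∸ 1) * q ^ n ≤ q ^ suc n ∸ q ^ c
    pred*^-≤ {c} {n} c≤n = begin
      (q ∸ 1) * q ^ n         ≡⟨ *-distribʳ-∸ (q ^ n) q 1 ⟩
      q ^ suc n ∸ 1 * q ^ n   ≡⟨ cong (q ^ suc n ∸_) (*-identityˡ (q ^ n)) ⟩
      q ^ suc n ∸ q ^ n       ≤⟨ ∸-monoʳ-≤ (q ^ suc n) (^-monoʳ-≤ q c≤n) ⟩
      q ^ suc n ∸ q ^ c       ∎
      where open ≤-Reasoning

    -- Multiplied out, this says [n+1, c]_q / [n, c]_q ≤ q^c · [a+1, z+1]_q / [a, z+1]_q.
    exchange-≤ : ∀ {c n} a z → c ≤ n →
      (q ^ suc n ∸ 1) * (q ^ a ∸ q ^ z) ≤ (q ^ suc n ∸ q ^ c) * ((q ^ suc a ∸ 1) * q ^ z)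
    exchange-≤ {c} {n} a z c≤n = begin
      (q ^ suc n ∸ 1) * (q ^ a ∸ q ^ z)
        ≤⟨ *-mono-≤ (m∸n≤m (q ^ suc n) 1) (^-∸-≤ a z) ⟩
      q ^ suc n * (q ^ z * (q ^ a ∸ 1))
        ≡⟨ solve 4 (λ x p r d → x :* p :* (r :* d) := p :* r :* (x :* d)) refl
             q (q ^ n) (q ^ z) (q ^ a ∸ 1) ⟩
      q ^ n * q ^ z * (q * (q ^ a ∸ 1))
        ≤⟨ *-monoʳ-≤ (q ^ n * q ^ z) (*-∸1-≤ s (q ^ a)) ⟩
      q ^ n * q ^ z * ((q ∸ 1) * (q ^ suc a ∸ 1))
        ≡⟨ solve 4 (λ p r x y → p :* r :* (x :* y) := x :* p :* (y :* r)) refl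
             (q ^ n) (q ^ z) (q ∸ 1) (q ^ suc a ∸ 1) ⟩
      (q ∸ 1) * q ^ n * ((q ^ suc a ∸ 1) * q ^ z)
        ≤⟨ *-monoˡ-≤ _ (pred*^-≤ c≤n) ⟩
      (q ^ suc n ∸ q ^ c) * ((q ^ suc a ∸ 1) * q ^ z) ∎
      where open ≤-Reasoning

    clearedPairs : ℕ → ℕ → ℕ → ℕ → ℕ
    clearedPairs c y n a = q ^ (a * c) * qFalling q n c * qFalling q a y

    clearedPairs-step : ∀ {c n} a z → c ≤ n →
      clearedPairs c (suc z) (suc n) a ≤ clearedPairs c (suc z) n (suc a)
    clearedPairs-step {c} {n} a z c≤n =
      *-cancelʳ-≤ _ _ (q ^ suc n ∸ q ^ c) {{>-nonZero (^-∸-pos (s≤s c≤n))}} (begin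
      clearedPairs c (suc z) (suc n) a * (q ^ suc n ∸ q ^ c)
        ≡⟨ solve 5 (λ p f g x d → p :* f :* (g :* d) :* x := p :* (f :* x) :* (g :* d)) refl
             (q ^ (a * c)) (qFalling q (suc n) c) (qFalling q a z) (q ^ suc n ∸ q ^ c) (q ^ a ∸ q ^ z) ⟩
      q ^ (a * c) * qFalling q (suc n) (suc c) * qFalling q a (suc z)
        ≡⟨ cong (λ f → q ^ (a * c) * f * qFalling q a (suc z)) (qFalling-suc q n c) ⟩
      q ^ (a * c) * ((q ^ suc n ∸ 1) * (q ^ c * qFalling q n c)) * (qFalling q a z * (q ^ a ∸ q ^ z))
        ≡⟨ solve 6 (λ p x r f g d → p :* (x :* (r :* f)) :* (g :* d) := r :* p :* f :* g :* (x :* d)) refl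
             (q ^ (a * c)) (q ^ suc n ∸ 1) (q ^ c) (qFalling q n c) (qFalling q a z) (q ^ a ∸ q ^ z) ⟩
      P * ((q ^ suc n ∸ 1) * (q ^ a ∸ q ^ z))
        ≤⟨ *-monoʳ-≤ P (exchange-≤ a z c≤n) ⟩
      P * ((q ^ suc n ∸ q ^ c) * ((q ^ suc a ∸ 1) * q ^ z))
        ≡⟨ solve 7 (λ r p f g x y w → r :* p :* f :* g :* (x :* (y :* w))
                                   := r :* p :* f :* (y :* (w :* g)) :* x) refl
             (q ^ c) (q ^ (a * c)) (qFalling q n c) (qFalling q a z)
             (q ^ suc n ∸ q ^ c) (q ^ suc a ∸ 1) (q ^ z) ⟩
      q ^ c * q ^ (a * c) * qFalling q n c * ((q ^ suc a ∸ 1) * (q ^ z * qFalling q a z)) * (q ^ suc n ∸ q ^ c)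
        ≡⟨ cong₂ (λ p f → p * qFalling q n c * f * (q ^ suc n ∸ q ^ c))
             (sym (^-distribˡ-+-* q c (a * c))) (sym (qFalling-suc q a z)) ⟩
      clearedPairs c (suc z) n (suc a) * (q ^ suc n ∸ q ^ c) ∎)
      where
      open ≤-Reasoning
      P = q ^ c * q ^ (a * c) * qFalling q n c * qFalling q a z

    clearedPairs-shift : ∀ {c k} a z d → c ≤ k →
      clearedPairs c (suc z) (k + d) a ≤ clearedPairs c (suc z) k (a + d)
    clearedPairs-shift {c} {k} a z zero c≤k
      rewrite +-identityʳ k | +-identityʳ a = ≤-refl
    clearedPairs-shift {c} {k} a z (suc d) c≤k = begin
      clearedPairs c (suc z) (k + suc d) a   ≡⟨ cong (λ n → clearedPairs c (suc z) n a) (+-suc k d) ⟩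
      clearedPairs c (suc z) (suc (k + d)) a ≤⟨ clearedPairs-step a z (≤-trans c≤k (m≤m+n k d)) ⟩
      clearedPairs c (suc z) (k + d) (suc a) ≤⟨ clearedPairs-shift (suc a) z d c≤k ⟩
      clearedPairs c (suc z) k (suc a + d)   ≡⟨ cong (clearedPairs c (suc z) k) (sym (+-suc a d)) ⟩
      clearedPairs c (suc z) k (a + suc d)   ∎
      where open ≤-Reasoning

module GaussianBinomial where
  open import Defs
  open QFalling
  open import Data.Nat as ℕ using (ℕ; zero; suc; 2+; z≤n; s≤s)
  import Data.Nat.Properties as ℕ
  open import Data.Nat.Divisibility using (∣1⇒≡1)
  open import Data.Integer as ℤ using (ℤ; +_; -[1+_]; +[1+_]; +≤+; 0ℤ)
  import Data.Integer.Properties as ℤ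
  open import Data.Rational as ℚ using (ℚ; mkℚ; 0ℚ; 1ℚ; _*_; _+_; _-_; _≤_; 1/_)
  import Data.Rational.Properties as ℚ
  open import Data.Rational.Solver using (module +-*-Solver)
  import Data.Integer.Solver as ℤ
  open import Data.Product using (_×_; _,_; proj₂)
  open import Data.Sum using (_⊎_; inj₁; inj₂; [_,_]′)
  open import Function using (_∘_)
  open import Relation.Binary.PropositionalEquality
  open import Relation.Nullary using (Dec; yes; no; ¬_; contradiction)
  open import Relation.Nullary.Decidable using (_×-dec_; toSum)

  -- The normal form of toℚ (+ n), which itself is stuck on a gcd computation.
  fromℕ : ℕ → ℚ
  fromℕ n = mkℚ (+ n) 0 (∣1⇒≡1 ∘ proj₂)

  toℚ-+ : ∀ n → toℚ (+ n) ≡ fromℕ n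
  toℚ-+ n = ℚ.↥p/↧p≡p (fromℕ n)

  fromℕ-homo-* : ∀ m n → fromℕ (m ℕ.* n) ≡ fromℕ m * fromℕ n
  fromℕ-homo-* m n = sym (trans (cong (ℚ._/ 1) (sym (ℤ.pos-* m n))) (toℚ-+ (m ℕ.* n)))

  fromℕ-homo-+ : ∀ m n → fromℕ (m ℕ.+ n) ≡ fromℕ m + fromℕ n
  fromℕ-homo-+ m n = sym (trans (cong (ℚ._/ 1)
    (trans (cong₂ ℤ._+_ (ℤ.*-identityʳ (+ m)) (ℤ.*-identityʳ (+ n))) (sym (ℤ.pos-+ m n))))
    (toℚ-+ (m ℕ.+ n)))

  fromℕ-homo-∸ : ∀ {m n} → n ℕ.≤ m → fromℕ (m ℕ.∸ n) ≡ fromℕ m - fromℕ n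
  fromℕ-homo-∸ {m} {n} n≤m = begin
    fromℕ (m ℕ.∸ n)
      ≡⟨ solve 2 (λ x y → x := x :+ y :- y) refl (fromℕ (m ℕ.∸ n)) (fromℕ n) ⟩
    fromℕ (m ℕ.∸ n) + fromℕ n - fromℕ n
      ≡⟨ cong (_- fromℕ n) (fromℕ-homo-+ (m ℕ.∸ n) n) ⟨
    fromℕ (m ℕ.∸ n ℕ.+ n) - fromℕ n
      ≡⟨ cong (λ x → fromℕ x - fromℕ n) (ℕ.m∸n+n≡m n≤m) ⟩
    fromℕ m - fromℕ n ∎
    where open ≡-Reasoning
          open +-*-Solver

  fromℕ-mono-≤ : ∀ {m n} → m ℕ.≤ n → fromℕ m ≤ fromℕ n
  fromℕ-mono-≤ {m} {n} m≤n =
    ℚ.*≤* (subst₂ ℤ._≤_ (sym (ℤ.*-identityʳ (+ m))) (sym (ℤ.*-identityʳ (+ n))) (+≤+ m≤n))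

  fromℕ-≢0 : ∀ {n} → 0 ℕ.< n → fromℕ n ≢ 0ℚ
  fromℕ-≢0 (s≤s _) ()

  fromℕ-pos : ∀ {n} → 0 ℕ.< n → ℚ.Positive (fromℕ n)
  fromℕ-pos (s≤s _) = _

  toℚ-^ℕ : ∀ q n → toℚ (+ q) ^ℕ n ≡ fromℕ (q ℕ.^ n)
  toℚ-^ℕ q zero    = refl
  toℚ-^ℕ q (suc n) = trans (cong₂ _*_ (toℚ-+ q) (toℚ-^ℕ q n)) (sym (fromℕ-homo-* q (q ℕ.^ n)))

  toℚ-^ℤ : ∀ q a c → toℚ (+ q) ^ℤ (+ a ℤ.* + c) ≡ fromℕ (q ℕ.^ (a ℕ.* c))
  toℚ-^ℤ q a c = trans (cong (toℚ (+ q) ^ℤ_) (sym (ℤ.pos-* a c))) (toℚ-^ℕ q (a ℕ.* c))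

  prodℚ-cong : ∀ m {f g : ℕ → ℚ} → (∀ {i} → i ℕ.< m → f i ≡ g i) → prodℚ m f ≡ prodℚ m g
  prodℚ-cong zero    f≗g = refl
  prodℚ-cong (suc m) f≗g = cong₂ _*_ (prodℚ-cong m (f≗g ∘ ℕ.m<n⇒m<1+n)) (f≗g ℕ.≤-refl)

  prodℚ-fromℕ : ∀ m f → prodℚ m (fromℕ ∘ f) ≡ fromℕ (prodℕ m f)
  prodℚ-fromℕ zero    f = refl
  prodℚ-fromℕ (suc m) f =
    trans (cong (_* fromℕ (f m)) (prodℚ-fromℕ m f)) (sym (fromℕ-homo-* (prodℕ m f) (f m)))

  ÷′-*-cancel : ∀ a {b} → b ≢ 0ℚ → (a ÷′ b) * b ≡ a
  ÷′-*-cancel a {b} b≢0 with b ℚ.≟ 0ℚ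
  ... | yes b≡0 = contradiction b≡0 b≢0
  ... | no  _   = begin
    a * 1/ b * b     ≡⟨ ℚ.*-assoc a (1/ b) b ⟩
    a * (1/ b * b)   ≡⟨ cong (a *_) (ℚ.*-inverseˡ b) ⟩
    a * 1ℚ           ≡⟨ ℚ.*-identityʳ a ⟩
    a                ∎
    where open ≡-Reasoning
          instance _ = ℚ.≢-nonZero b≢0

  1/-nonneg : ∀ b .{{_ : ℚ.NonZero b}} → 0ℚ ≤ b → 0ℚ ≤ 1/ b
  1/-nonneg b@(mkℚ +[1+ _ ] _ _) _ = ℚ.nonNegative⁻¹ (1/ b)
  1/-nonneg b@(mkℚ -[1+ _ ] _ _) 0≤b with () ← ℚ.nonNegative 0≤b

  *-nonneg : ∀ {a b} → 0ℚ ≤ a → 0ℚ ≤ b → 0ℚ ≤ a * b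
  *-nonneg {a} {b} 0≤a 0≤b =
    ℚ.nonNegative⁻¹ _ {{ℚ.nonNeg*nonNeg⇒nonNeg a {{ℚ.nonNegative 0≤a}} b {{ℚ.nonNegative 0≤b}}}}

  ÷′-nonneg : ∀ {a b} → 0ℚ ≤ a → 0ℚ ≤ b → 0ℚ ≤ a ÷′ b
  ÷′-nonneg {a} {b} 0≤a 0≤b with b ℚ.≟ 0ℚ
  ... | yes _   = ℚ.≤-refl
  ... | no  b≢0 = *-nonneg 0≤a (1/-nonneg b {{ℚ.≢-nonZero b≢0}} 0≤b)

  ^ℕ-nonneg : ∀ {x} n → 0ℚ ≤ x → 0ℚ ≤ x ^ℕ n
  ^ℕ-nonneg zero    _   = ℚ.nonNegative⁻¹ 1ℚ
  ^ℕ-nonneg (suc n) 0≤x = *-nonneg 0≤x (^ℕ-nonneg n 0≤x)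

  ^ℤ-nonneg : ∀ {x} i → 0ℚ ≤ x → 0ℚ ≤ x ^ℤ i
  ^ℤ-nonneg (+ n)    0≤x = ^ℕ-nonneg n 0≤x
  ^ℤ-nonneg -[1+ n ] 0≤x = ÷′-nonneg (ℚ.nonNegative⁻¹ 1ℚ) (^ℕ-nonneg (suc n) 0≤x)

  prodℚ-÷′ : ∀ m (f g : ℕ → ℚ) → (∀ {i} → i ℕ.< m → g i ≢ 0ℚ) →
    prodℚ m (λ i → f i ÷′ g i) * prodℚ m g ≡ prodℚ m f
  prodℚ-÷′ zero    f g g≢0 = refl
  prodℚ-÷′ (suc m) f g g≢0 = begin
    prodℚ m (λ i → f i ÷′ g i) * (f m ÷′ g m) * (prodℚ m g * g m)
      ≡⟨ solve 4 (λ p x r y → p :* x :* (r :* y) := p :* r :* (x :* y)) refl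
           (prodℚ m (λ i → f i ÷′ g i)) (f m ÷′ g m) (prodℚ m g) (g m) ⟩
    prodℚ m (λ i → f i ÷′ g i) * prodℚ m g * ((f m ÷′ g m) * g m)
      ≡⟨ cong₂ _*_ (prodℚ-÷′ m f g (g≢0 ∘ ℕ.m<n⇒m<1+n)) (÷′-*-cancel (f m) (g≢0 ℕ.≤-refl)) ⟩
    prodℚ m f * f m ∎
    where open ≡-Reasoning
          open +-*-Solver

  gauss-inside : ∀ q {n m} → m ℕ.≤ n → gauss q (+ n) (+ m) ≡
    prodℚ m (λ i → (toℚ q ^ℕ n - toℚ q ^ℕ i) ÷′ (toℚ q ^ℕ m - toℚ q ^ℕ i))
  gauss-inside q {n} {m} m≤n with 0ℤ ℤ.≤? + m ×-dec + m ℤ.≤? + n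
  ... | yes _ = refl
  ... | no m∉[0,n] = contradiction (+≤+ z≤n , +≤+ m≤n) m∉[0,n]

  gauss-outside : ∀ q {n m} → ¬ (0ℤ ℤ.≤ m × m ℤ.≤ n) → gauss q n m ≡ 0ℚ
  gauss-outside q {n} {m} m∉[0,n] with 0ℤ ℤ.≤? m ×-dec m ℤ.≤? n
  ... | yes m∈[0,n] = contradiction m∈[0,n] m∉[0,n]
  ... | no _ = refl

  i-m≡i-[m+n]+n : ∀ i m n → i ℤ.- + m ≡ i ℤ.- + (m ℕ.+ n) ℤ.+ + n
  i-m≡i-[m+n]+n i m n = solve 3 (λ i m n → i :- m := i :- (m :+ n) :+ n) refl i (+ m) (+ n)
    where open ℤ.+-*-Solver

  module _ (s : ℕ) where
    private
      q = 2+ s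

    toℚ-^ℕ-∸ : ∀ {i n} → i ℕ.≤ n → toℚ (+ q) ^ℕ n - toℚ (+ q) ^ℕ i ≡ fromℕ (q ℕ.^ n ℕ.∸ q ℕ.^ i)
    toℚ-^ℕ-∸ {i} {n} i≤n =
      trans (cong₂ _-_ (toℚ-^ℕ q n) (toℚ-^ℕ q i)) (sym (fromℕ-homo-∸ (ℕ.^-monoʳ-≤ q i≤n)))

    gauss-*-qFalling : ∀ {n m} → m ℕ.≤ n →
      gauss (+ q) (+ n) (+ m) * fromℕ (qFalling q m m) ≡ fromℕ (qFalling q n m)
    gauss-*-qFalling {n} {m} m≤n = begin
      gauss (+ q) (+ n) (+ m) * fromℕ (qFalling q m m)
        ≡⟨ cong₂ _*_ (gauss-inside (+ q) m≤n) (sym (prodℚ-[q^-q^] ℕ.≤-refl)) ⟩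
      prodℚ m (λ i → [q^ n -q^ i ] ÷′ [q^ m -q^ i ]) * prodℚ m [q^ m -q^_]
        ≡⟨ prodℚ-÷′ m [q^ n -q^_] [q^ m -q^_] [q^m-q^i]≢0 ⟩
      prodℚ m [q^ n -q^_]
        ≡⟨ prodℚ-[q^-q^] m≤n ⟩
      fromℕ (qFalling q n m) ∎
      where
      open ≡-Reasoning
      [q^_-q^_] : ℕ → ℕ → ℚ
      [q^ a -q^ i ] = toℚ (+ q) ^ℕ a - toℚ (+ q) ^ℕ i
      prodℚ-[q^-q^] : ∀ {a} → m ℕ.≤ a → prodℚ m [q^ a -q^_] ≡ fromℕ (qFalling q a m)
      prodℚ-[q^-q^] m≤a =
        trans (prodℚ-cong m (λ i<m → toℚ-^ℕ-∸ (ℕ.≤-trans (ℕ.<⇒≤ i<m) m≤a))) (prodℚ-fromℕ m _)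
      [q^m-q^i]≢0 : ∀ {i} → i ℕ.< m → [q^ m -q^ i ] ≢ 0ℚ
      [q^m-q^i]≢0 i<m = subst (_≢ 0ℚ) (sym (toℚ-^ℕ-∸ (ℕ.<⇒≤ i<m))) (fromℕ-≢0 (^-∸-pos s i<m))

    gauss-nonneg : ∀ n m → 0ℚ ≤ gauss (+ q) n m
    gauss-nonneg n m@(-[1+ _ ]) = ℚ.≤-reflexive (sym (gauss-outside (+ q) {n} {m} λ { (() , _) }))
    gauss-nonneg n@(-[1+ _ ]) m@(+ _) = ℚ.≤-reflexive (sym (gauss-outside (+ q) {n} {m} λ { (_ , ()) }))
    gauss-nonneg (+ n) (+ m) = nonneg (m ℕ.≤? n)
      where
      nonneg : Dec (m ℕ.≤ n) → 0ℚ ≤ gauss (+ q) (+ n) (+ m)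
      nonneg (no m≰n) = ℚ.≤-reflexive (sym (gauss-outside (+ q) (m≰n ∘ ℤ.drop‿+≤+ ∘ proj₂)))
      nonneg (yes m≤n) = ℚ.*-cancelʳ-≤-pos d {{fromℕ-pos (qFalling-pos s m ℕ.≤-refl)}}
        (subst₂ _≤_ (sym (ℚ.*-zeroˡ d)) (sym (gauss-*-qFalling m≤n)) (fromℕ-mono-≤ z≤n))
        where d = fromℕ (qFalling q m m)

    -- For n = w − t this counts the pairs (C, Y) of a c-subspace C of a w-space meeting a fixed
    -- t-subspace T trivially and a y-subspace Y of T.
    pairs : ℤ → ℤ → ℤ → ℤ → ℚ
    pairs c n y t = toℚ (+ q) ^ℤ (t ℤ.* c) * gauss (+ q) n c * gauss (+ q) t y

    pairs-nonneg : ∀ c n y t → 0ℚ ≤ pairs c n y t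
    pairs-nonneg c n y t =
      *-nonneg (*-nonneg (^ℤ-nonneg (t ℤ.* c) 0≤q) (gauss-nonneg n c)) (gauss-nonneg t y)
      where 0≤q = subst (0ℚ ≤_) (sym (toℚ-+ q)) (fromℕ-mono-≤ z≤n)

    pairs-*-qFalling : ∀ {c n y a} → c ℕ.≤ n → y ℕ.≤ a →
      pairs (+ c) (+ n) (+ y) (+ a) * (fromℕ (qFalling q c c) * fromℕ (qFalling q y y))
        ≡ fromℕ (clearedPairs s c y n a)
    pairs-*-qFalling {c} {n} {y} {a} c≤n y≤a = begin
      toℚ (+ q) ^ℤ (+ a ℤ.* + c) * g₁ * g₂ * (d₁ * d₂)
        ≡⟨ solve 5 (λ p x u z v → p :* x :* u :* (z :* v) := p :* (x :* z) :* (u :* v)) refl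
             (toℚ (+ q) ^ℤ (+ a ℤ.* + c)) g₁ g₂ d₁ d₂ ⟩
      toℚ (+ q) ^ℤ (+ a ℤ.* + c) * (g₁ * d₁) * (g₂ * d₂)
        ≡⟨ cong₂ _*_ (cong₂ _*_ (toℚ-^ℤ q a c) (gauss-*-qFalling c≤n)) (gauss-*-qFalling y≤a) ⟩
      fromℕ (q ℕ.^ (a ℕ.* c)) * fromℕ (qFalling q n c) * fromℕ (qFalling q a y)
        ≡⟨ cong (_* fromℕ (qFalling q a y)) (fromℕ-homo-* (q ℕ.^ (a ℕ.* c)) (qFalling q n c)) ⟨
      fromℕ (q ℕ.^ (a ℕ.* c) ℕ.* qFalling q n c) * fromℕ (qFalling q a y)
        ≡⟨ fromℕ-homo-* (q ℕ.^ (a ℕ.* c) ℕ.* qFalling q n c) (qFalling q a y) ⟨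
      fromℕ (clearedPairs s c y n a) ∎
      where
      open ≡-Reasoning
      open +-*-Solver
      g₁ = gauss (+ q) (+ n) (+ c)
      g₂ = gauss (+ q) (+ a) (+ y)
      d₁ = fromℕ (qFalling q c c)
      d₂ = fromℕ (qFalling q y y)

    pairs-shift : ∀ {c k} a z d → + c ℤ.≤ k → suc z ℕ.≤ a →
      pairs (+ c) (k ℤ.+ + d) (+ suc z) (+ a) ≤ pairs (+ c) k (+ suc z) (+ (a ℕ.+ d))
    pairs-shift {c} {+ k} a z d (+≤+ c≤k) y≤a = ℚ.*-cancelʳ-≤-pos (d₁ * d₂) {{d₁*d₂-pos}} (begin
      pairs (+ c) (+ (k ℕ.+ d)) (+ suc z) (+ a) * (d₁ * d₂)
        ≡⟨ pairs-*-qFalling (ℕ.≤-trans c≤k (ℕ.m≤m+n k d)) y≤a ⟩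
      fromℕ (clearedPairs s c (suc z) (k ℕ.+ d) a)
        ≤⟨ fromℕ-mono-≤ (clearedPairs-shift s a z d c≤k) ⟩
      fromℕ (clearedPairs s c (suc z) k (a ℕ.+ d))
        ≡⟨ pairs-*-qFalling c≤k (ℕ.≤-trans y≤a (ℕ.m≤m+n a d)) ⟨
      pairs (+ c) (+ k) (+ suc z) (+ (a ℕ.+ d)) * (d₁ * d₂) ∎)
      where
      open ℚ.≤-Reasoning
      d₁ = fromℕ (qFalling q c c)
      d₂ = fromℕ (qFalling q (suc z) (suc z))
      d₁*d₂-pos : ℚ.Positive (d₁ * d₂)
      d₁*d₂-pos = ℚ.pos*pos⇒pos d₁ {{fromℕ-pos (qFalling-pos s c ℕ.≤-refl)}}
                                d₂ {{fromℕ-pos (qFalling-pos s (suc z) ℕ.≤-refl)}}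

    pairs-vanishes : ∀ c n y t → ¬ (0ℤ ℤ.≤ c × c ℤ.≤ n) ⊎ ¬ (0ℤ ℤ.≤ y × y ℤ.≤ t) →
      pairs c n y t ≡ 0ℚ
    pairs-vanishes c n y t (inj₁ c∉[0,n]) = begin
      p * gauss (+ q) n c * gauss (+ q) t y
        ≡⟨ cong (λ g → p * g * gauss (+ q) t y) (gauss-outside (+ q) c∉[0,n]) ⟩
      p * 0ℚ * gauss (+ q) t y
        ≡⟨ cong (_* gauss (+ q) t y) (ℚ.*-zeroʳ p) ⟩
      0ℚ * gauss (+ q) t y
        ≡⟨ ℚ.*-zeroˡ (gauss (+ q) t y) ⟩
      0ℚ ∎
      where open ≡-Reasoning
            p = toℚ (+ q) ^ℤ (t ℤ.* c)
    pairs-vanishes c n y t (inj₂ y∉[0,t]) = begin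
      p * gauss (+ q) n c * gauss (+ q) t y
        ≡⟨ cong (p * gauss (+ q) n c *_) (gauss-outside (+ q) y∉[0,t]) ⟩
      p * gauss (+ q) n c * 0ℚ
        ≡⟨ ℚ.*-zeroʳ (p * gauss (+ q) n c) ⟩
      0ℚ ∎
      where open ≡-Reasoning
            p = toℚ (+ q) ^ℤ (t ℤ.* c)

    pairs-vanishes-≤ : ∀ c k y t₀ t → ¬ (0ℤ ℤ.≤ c × c ℤ.≤ k ℤ.- t₀) ⊎ ¬ (0ℤ ℤ.≤ y × y ℤ.≤ t₀) →
      pairs c (k ℤ.- t₀) y t₀ ≤ pairs c (k ℤ.- t) y t
    pairs-vanishes-≤ c k y t₀ t vanish =
      subst (_≤ _) (sym (pairs-vanishes c (k ℤ.- t₀) y t₀ vanish)) (pairs-nonneg c (k ℤ.- t) y t)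

    pairs-mono⁺ : ∀ c k z {t₀ t} → + c ℤ.≤ k ℤ.- t → t₀ ℤ.≤ t → + suc z ℤ.≤ t₀ →
      pairs (+ c) (k ℤ.- t₀) (+ suc z) t₀ ≤ pairs (+ c) (k ℤ.- t) (+ suc z) t
    pairs-mono⁺ c k z {+ a} {+ b} c≤k-b (+≤+ a≤b) (+≤+ y≤a)
      with d , refl ← ℕ.m≤n⇒∃[o]m+o≡n a≤b
      rewrite i-m≡i-[m+n]+n k a d = pairs-shift a z d c≤k-b y≤a

    pairs-mono : ∀ c k y t₀ t → y ≢ 0ℤ → c ℤ.≤ k ℤ.- t → t₀ ℤ.≤ t →
      pairs c (k ℤ.- t₀) y t₀ ≤ pairs c (k ℤ.- t) y t
    pairs-mono c@(-[1+ _ ]) k y t₀ t _ _ _ = pairs-vanishes-≤ c k y t₀ t (inj₁ λ { (() , _) })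
    pairs-mono (+ c) k y@(-[1+ _ ]) t₀ t _ _ _ = pairs-vanishes-≤ (+ c) k y t₀ t (inj₂ λ { (() , _) })
    pairs-mono (+ c) k (+ zero) t₀ t y≢0 _ _ = contradiction refl y≢0
    pairs-mono (+ c) k (+ suc z) t₀ t _ c≤k-t t₀≤t =
      [ pairs-mono⁺ c k z c≤k-t t₀≤t
      , (λ y≰t₀ → pairs-vanishes-≤ (+ c) k (+ suc z) t₀ t (inj₂ (y≰t₀ ∘ proj₂)))
      ]′ (toSum (+ suc z ℤ.≤? t₀))

open import Defs
open import Data.Integer using (ℤ; _-_; _≤_)
open import Data.Rational using (_*_) renaming (_≤_ to _≤ℚ_)
open import Relation.Binary.PropositionalEquality using (_≢_)
import Data.Integer as ℤ
open import Data.Nat as ℕ using (2+)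
import Data.Nat.Properties as ℕ
open import Data.Nat.Primality using (Prime; prime⇒nonTrivial)
open import Data.Product using (_,_)
open import Relation.Binary.PropositionalEquality using (refl)
open GaussianBinomial using (pairs-mono)

primePower≥2 : ∀ {p e} → Prime p → 1 ℕ.≤ e → 2 ℕ.≤ p ℕ.^ e
primePower≥2 {p} {ℕ.suc e} p-prime _ = ℕ.≤-trans (ℕ.nonTrivial⇒n>1 p) (ℕ.m≤m*n p (p ℕ.^ e))
  where instance
    _ = prime⇒nonTrivial p-prime
    _ = ℕ.m^n≢0 p e {{ℕ.nonTrivial⇒nonZero p}}

lemma9 : (c k q t t₀ y : ℤ) → IsPrimePower q → y ≢ ℤ.0ℤ → c ≤ k - t → t₀ ≤ t →
    ((toℚ q ^ℤ (t₀ ℤ.* c)) * gauss q (k - t₀) c) * gauss q t₀ y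
      ≤ℚ ((toℚ q ^ℤ (t ℤ.* c)) * gauss q (k - t) c) * gauss q t y
lemma9 c k _ t t₀ y (p , e , p-prime , 1≤e , refl) with p ℕ.^ e | primePower≥2 p-prime 1≤e
... | 2+ s | _ = pairs-mono s c k y t₀ t
... | 1    | ℕ.s≤s ()
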